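{- Let $\xi$ be an all-small position whose only Right option is $0$. Then $\mathsf{L}(\xi)\equiv 0 \pmod{\mathrm{cl}(\mathsf{L}(\xi))}$, where $\mathsf{L}(\xi)=\{\xi\mid\cdot\}$.
   Context: A position $\xi=\{\xi^L \mid \xi^R\}$ is given recursively by finite sets of Left and Right options; $\cdot$ denotes an empty set; $0=\{\cdot\mid\cdot\}$. A position is all-small if Left can move in it iff Right can, and every option is all-small. Disjunctive sum: $\alpha+\beta=\{\alpha^L+\beta,\alpha+\beta^L \mid \alpha^R+\beta,\alpha+\beta^R\}$. Under misère play a player unable to move on their turn wins; $o^-(\xi)\in\{\mathcal{L},\mathcal{R},\mathcal{N},\mathcal{P}\}$ is the misère outcome (Left wins always / Right wins always / next player wins / next player loses). $\mathrm{cl}(\Upsilon)$ is the smallest set containing $\Upsilon$ closed under disjunctive sum and taking options. For a closed set $\Gamma$ and $\alpha,\beta\in\Gamma$, $\alpha\equiv\beta\pmod\Gamma$ means $o^-(\alpha+\gamma)=o^-(\beta+\gamma)$ for all $\gamma\in\Gamma$. -}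

module Defs where

open import Data.List using (List; []; _∷_; _++_)
open import Data.List.Membership.Propositional using (_∈_)
open import Data.List.Relation.Unary.All using (All)
open import Data.Bool using (Bool; true; false; not; _∨_)
open import Data.Product using (_×_; Σ)
open import Relation.Binary.PropositionalEquality using (_≡_)
open import Relation.Nullary using (¬_)

data Game : Set where
  ⟨_∣_⟩ : List Game → List Game → Game

Lopts : Game → List Game
Lopts ⟨ l ∣ r ⟩ = l

Ropts : Game → List Game
Ropts ⟨ l ∣ r ⟩ = r

zeroG : Game
zeroG = ⟨ [] ∣ [] ⟩

Lof : Game → Game
Lof ξ = ⟨ ξ ∷ [] ∣ [] ⟩

mutual
  _⊕_ : Game → Game → Game
  ⟨ al ∣ ar ⟩ ⊕ ⟨ bl ∣ br ⟩ =
    ⟨ sumL al ⟨ bl ∣ br ⟩ ++ sumR ⟨ al ∣ ar ⟩ bl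
    ∣ sumL ar ⟨ bl ∣ br ⟩ ++ sumR ⟨ al ∣ ar ⟩ br ⟩

  sumL : List Game → Game → List Game
  sumL [] b = []
  sumL (x ∷ xs) b = (x ⊕ b) ∷ sumL xs b

  sumR : Game → List Game → List Game
  sumR a [] = []
  sumR a (y ∷ ys) = (a ⊕ y) ∷ sumR a ys

data IsEmpty {A : Set} : List A → Set where
  empty : IsEmpty []

data AllSmall : Game → Set where
  allSmall : ∀ {l r} →
    (IsEmpty l → IsEmpty r) → (IsEmpty r → IsEmpty l) →
    All AllSmall l → All AllSmall r → AllSmall ⟨ l ∣ r ⟩

-- Misère play: a player unable to move on their turn wins.
mutual
  leftFirstWins : Game → Bool
  leftFirstWins ⟨ [] ∣ r ⟩ = true
  leftFirstWins ⟨ x ∷ l ∣ r ⟩ = someLeftGood (x ∷ l)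

  someLeftGood : List Game → Bool
  someLeftGood [] = false
  someLeftGood (x ∷ xs) = not (rightFirstWins x) ∨ someLeftGood xs

  rightFirstWins : Game → Bool
  rightFirstWins ⟨ l ∣ [] ⟩ = true
  rightFirstWins ⟨ l ∣ x ∷ r ⟩ = someRightGood (x ∷ r)

  someRightGood : List Game → Bool
  someRightGood [] = false
  someRightGood (x ∷ xs) = not (leftFirstWins x) ∨ someRightGood xs

data Outcome : Set where
  𝓛 𝓡 𝓝 𝓟 : Outcome

outcomeOf : Bool → Bool → Outcome
outcomeOf true  true  = 𝓝
outcomeOf true  false = 𝓛
outcomeOf false true  = 𝓡
outcomeOf false false = 𝓟

o⁻ : Game → Outcome
o⁻ g = outcomeOf (leftFirstWins g) (rightFirstWins g)

data Cl (Υ : Game → Set) : Game → Set where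
  base : ∀ {g} → Υ g → Cl Υ g
  sum  : ∀ {a b} → Cl Υ a → Cl Υ b → Cl Υ (a ⊕ b)
  optL : ∀ {g x} → Cl Υ g → x ∈ Lopts g → Cl Υ x
  optR : ∀ {g x} → Cl Υ g → x ∈ Ropts g → Cl Υ x

_≡_mod_ : Game → Game → (Game → Set) → Set
α ≡ β mod Γ = Γ α × Γ β × (∀ γ → Γ γ → o⁻ (α ⊕ γ) ≡ o⁻ (β ⊕ γ))

OnlyRightOptionZero : Game → Set
OnlyRightOptionZero ξ = (zeroG ∈ Ropts ξ) × All (_≡ zeroG) (Ropts ξ)

module Submission where

-- Put X = 𝖫(ξ) = {ξ | ·}.  Call a position *Left-end-zero* if every
-- subposition in which Left cannot move is 0 itself; all-small positions are
-- Left-end-zero, the class is closed under sums and options, and it contains X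
-- whenever it contains ξ, hence it contains all of cl(X).  The heart of the proof
-- is that adding X to a Left-end-zero position g changes neither who wins moving
-- first: Right cannot move in X, and Left's extra move X + g → ξ + g never helps,
-- since Right answers ξ + g → 0 + g = g, where Left is now to move — which is
-- exactly a Left-first game on g.  Conversely when g = 0, the move X → ξ is Left's
-- only move and wins, because every Right move from ξ leads to 0, where Left wins
-- by having no move.  Since 0 + g = g, this gives o⁻(X + γ) = o⁻(0 + γ) on cl(X).

open import Defs
open import Relation.Binary.PropositionalEquality
  using (_≡_; refl; cong; cong₂; trans; module ≡-Reasoning)
open import Data.List using ([]; _∷_)
open import Data.List.Properties using (++-identityʳ)
open import Data.List.Membership.Propositional using (_∈_)
open import Data.List.Membership.Propositional.Properties using (∈-++⁺ˡ)
open import Data.List.Relation.Unary.All as All using (All; []; _∷_; lookup)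
open import Data.List.Relation.Unary.All.Properties using (++⁺)
open import Data.List.Relation.Unary.Any using (here; there)
open import Data.Bool using (Bool; true; false; not; _∨_)
open import Data.Bool.Properties using (∨-zeroʳ)
open import Data.Product using (_,_; proj₁; proj₂)

mutual
  ⊕-identityˡ : ∀ g → zeroG ⊕ g ≡ g
  ⊕-identityˡ ⟨ l ∣ r ⟩ = cong₂ ⟨_∣_⟩ (sumR-zeroG l) (sumR-zeroG r)

  sumR-zeroG : ∀ xs → sumR zeroG xs ≡ xs
  sumR-zeroG []       = refl
  sumR-zeroG (x ∷ xs) = cong₂ _∷_ (⊕-identityˡ x) (sumR-zeroG xs)

mutual
  ⊕-identityʳ : ∀ g → g ⊕ zeroG ≡ g
  ⊕-identityʳ ⟨ l ∣ r ⟩ =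
    cong₂ ⟨_∣_⟩ (trans (++-identityʳ _) (sumL-zeroG l))
                (trans (++-identityʳ _) (sumL-zeroG r))

  sumL-zeroG : ∀ xs → sumL xs zeroG ≡ xs
  sumL-zeroG []       = refl
  sumL-zeroG (x ∷ xs) = cong₂ _∷_ (⊕-identityʳ x) (sumL-zeroG xs)

∈-sumL : ∀ {x xs} b → x ∈ xs → x ⊕ b ∈ sumL xs b
∈-sumL b (here refl) = here refl
∈-sumL b (there x∈)  = there (∈-sumL b x∈)

∈-Ropts-⊕ : ∀ {x} a b → x ∈ Ropts a → x ⊕ b ∈ Ropts (a ⊕ b)
∈-Ropts-⊕ ⟨ _ ∣ _ ⟩ ⟨ _ ∣ _ ⟩ x∈ = ∈-++⁺ˡ (∈-sumL _ x∈)

someRightGood-true : ∀ {x xs} → x ∈ xs → leftFirstWins x ≡ false →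
                     someRightGood xs ≡ true
someRightGood-true (here refl) lose = cong (λ b → not b ∨ _) lose
someRightGood-true {xs = y ∷ _} (there x∈) lose =
  trans (cong (not (leftFirstWins y) ∨_) (someRightGood-true x∈ lose))
        (∨-zeroʳ _)

someRightGood-false : ∀ {xs} → All (λ x → leftFirstWins x ≡ true) xs →
                      someRightGood xs ≡ false
someRightGood-false []           = refl
someRightGood-false (win ∷ wins) = trans (cong (λ b → not b ∨ _) win)
                                         (someRightGood-false wins)

rightFirstWins-byOption : ∀ g {x} → x ∈ Ropts g → leftFirstWins x ≡ false →
                          rightFirstWins g ≡ true
rightFirstWins-byOption ⟨ _ ∣ _ ∷ _ ⟩ x∈ lose = someRightGood-true x∈ lose

rightFirstLoses : ∀ g {x} → x ∈ Ropts g →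
                  All (λ y → leftFirstWins y ≡ true) (Ropts g) →
                  rightFirstWins g ≡ false
rightFirstLoses ⟨ _ ∣ _ ∷ _ ⟩ _ wins = someRightGood-false wins

data LeftEndZero : Game → Set where
  end  : LeftEndZero ⟨ [] ∣ [] ⟩
  move : ∀ {x l r} → All LeftEndZero (x ∷ l) → All LeftEndZero r →
         LeftEndZero ⟨ x ∷ l ∣ r ⟩

leftOptions : ∀ {g} → LeftEndZero g → All LeftEndZero (Lopts g)
leftOptions end         = []
leftOptions (move pl _) = pl

rightOptions : ∀ {g} → LeftEndZero g → All LeftEndZero (Ropts g)
rightOptions end         = []
rightOptions (move _ pr) = pr

-- All-small positions are Left-end-zero (only "no Left move ⇒ no Right move" is used).
mutual
  allSmall⇒leftEndZero : ∀ {g} → AllSmall g → LeftEndZero g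
  allSmall⇒leftEndZero (allSmall {[]} noL⇒noR _ _ _) with noL⇒noR empty
  ... | empty = end
  allSmall⇒leftEndZero (allSmall {_ ∷ _} _ _ sl sr) =
    move (allSmall⇒leftEndZeros sl) (allSmall⇒leftEndZeros sr)

  allSmall⇒leftEndZeros : ∀ {xs} → All AllSmall xs → All LeftEndZero xs
  allSmall⇒leftEndZeros []       = []
  allSmall⇒leftEndZeros (s ∷ ss) = allSmall⇒leftEndZero s ∷ allSmall⇒leftEndZeros ss

-- The class is closed under disjunctive sum: a Left end of a + b is a Left end of
-- both components, hence 0 + 0 = 0.
mutual
  ⊕-leftEndZero : ∀ {a b} → LeftEndZero a → LeftEndZero b → LeftEndZero (a ⊕ b)
  ⊕-leftEndZero end end = end
  ⊕-leftEndZero end (move pl pr) = move (sumR-leftEndZero end pl) (sumR-leftEndZero end pr)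
  ⊕-leftEndZero {b = ⟨ _ ∣ _ ⟩} pa@(move pl pr) pb =
    move (++⁺ (sumL-leftEndZero pl pb) (sumR-leftEndZero pa (leftOptions pb)))
         (++⁺ (sumL-leftEndZero pr pb) (sumR-leftEndZero pa (rightOptions pb)))

  sumL-leftEndZero : ∀ {xs b} → All LeftEndZero xs → LeftEndZero b →
                     All LeftEndZero (sumL xs b)
  sumL-leftEndZero []         pb = []
  sumL-leftEndZero (px ∷ pxs) pb = ⊕-leftEndZero px pb ∷ sumL-leftEndZero pxs pb

  sumR-leftEndZero : ∀ {a ys} → LeftEndZero a → All LeftEndZero ys →
                     All LeftEndZero (sumR a ys)
  sumR-leftEndZero pa []         = []
  sumR-leftEndZero pa (py ∷ pys) = ⊕-leftEndZero pa py ∷ sumR-leftEndZero pa pys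

Cl-leftEndZero : ∀ {Υ : Game → Set} → (∀ {g} → Υ g → LeftEndZero g) →
                 ∀ {γ} → Cl Υ γ → LeftEndZero γ
Cl-leftEndZero inΥ (base υ)   = inΥ υ
Cl-leftEndZero inΥ (sum c d)  = ⊕-leftEndZero (Cl-leftEndZero inΥ c) (Cl-leftEndZero inΥ d)
Cl-leftEndZero inΥ (optL c m) = lookup (leftOptions (Cl-leftEndZero inΥ c)) m
Cl-leftEndZero inΥ (optR c m) = lookup (rightOptions (Cl-leftEndZero inΥ c)) m

-- A Left option that Right can always refute adds nothing to a disjunction.
not-absorbed : ∀ c b → (b ≡ false → c ≡ true) → not c ∨ b ≡ b
not-absorbed true  b     _       = refl
not-absorbed false true  _       = refl
not-absorbed false false refute with refute refl
... | ()

module Absorption (ξ : Game) (onlyZero : OnlyRightOptionZero ξ) where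

  X : Game
  X = Lof ξ

  -- Right refutes ξ + g by moving to 0 + g = g whenever Left loses moving first in g.
  refute-ξ⊕ : ∀ g → leftFirstWins g ≡ false → rightFirstWins (ξ ⊕ g) ≡ true
  refute-ξ⊕ g lose =
    rightFirstWins-byOption (ξ ⊕ g) (∈-Ropts-⊕ ξ g (proj₁ onlyZero))
                            (trans (cong leftFirstWins (⊕-identityˡ g)) lose)

  -- Right loses moving first in ξ: each of his moves reaches 0, where Left wins.
  rightFirstLoses-ξ⊕0 : rightFirstWins (ξ ⊕ zeroG) ≡ false
  rightFirstLoses-ξ⊕0 =
    trans (cong rightFirstWins (⊕-identityʳ ξ))
          (rightFirstLoses ξ (proj₁ onlyZero)
                           (All.map (λ { refl → refl }) (proj₂ onlyZero)))

  mutual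
    leftFirstWins-X⊕ : ∀ {g} → LeftEndZero g → leftFirstWins (X ⊕ g) ≡ leftFirstWins g
    leftFirstWins-X⊕ end = cong (λ c → not c ∨ false) rightFirstLoses-ξ⊕0
    leftFirstWins-X⊕ {g} (move pl _) = begin
      not c ∨ someLeftGood (sumR X (Lopts g)) ≡⟨ cong (not c ∨_) (someLeftGood-X⊕ pl) ⟩
      not c ∨ leftFirstWins g                 ≡⟨ not-absorbed c _ (refute-ξ⊕ g) ⟩
      leftFirstWins g                         ∎
      where
        open ≡-Reasoning
        c : Bool
        c = rightFirstWins (ξ ⊕ g)

    rightFirstWins-X⊕ : ∀ {g} → LeftEndZero g → rightFirstWins (X ⊕ g) ≡ rightFirstWins g
    rightFirstWins-X⊕ end                 = refl
    rightFirstWins-X⊕ (move _ [])         = refl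
    rightFirstWins-X⊕ (move _ pr@(_ ∷ _)) = someRightGood-X⊕ pr

    someLeftGood-X⊕ : ∀ {xs} → All LeftEndZero xs →
                      someLeftGood (sumR X xs) ≡ someLeftGood xs
    someLeftGood-X⊕ []         = refl
    someLeftGood-X⊕ (px ∷ pxs) =
      cong₂ (λ a b → not a ∨ b) (rightFirstWins-X⊕ px) (someLeftGood-X⊕ pxs)

    someRightGood-X⊕ : ∀ {xs} → All LeftEndZero xs →
                       someRightGood (sumR X xs) ≡ someRightGood xs
    someRightGood-X⊕ []         = refl
    someRightGood-X⊕ (px ∷ pxs) =
      cong₂ (λ a b → not a ∨ b) (leftFirstWins-X⊕ px) (someRightGood-X⊕ pxs)

  outcome-X⊕ : ∀ {g} → LeftEndZero g → o⁻ (X ⊕ g) ≡ o⁻ (zeroG ⊕ g)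
  outcome-X⊕ {g} pg = begin
    o⁻ (X ⊕ g)
      ≡⟨ cong₂ outcomeOf (leftFirstWins-X⊕ pg) (rightFirstWins-X⊕ pg) ⟩
    o⁻ g
      ≡⟨ cong o⁻ (⊕-identityˡ g) ⟨
    o⁻ (zeroG ⊕ g) ∎
    where open ≡-Reasoning

proposition7p2p1 : (ξ : Game) → AllSmall ξ → OnlyRightOptionZero ξ →
    Lof ξ ≡ zeroG mod Cl (_≡ Lof ξ)
proposition7p2p1 ξ small onlyZero = X∈cl , zero∈cl , λ γ γ∈cl → outcome-X⊕ (cl⊆ γ∈cl)
  where
    open Absorption ξ onlyZero
    X∈cl : Cl (_≡ X) X
    X∈cl = base refl
    -- 0 is a Right option of ξ, which is the Left option of X.
    zero∈cl : Cl (_≡ X) zeroG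
    zero∈cl = optR (optL X∈cl (here refl)) (proj₁ onlyZero)
    -- every element of cl(X) is Left-end-zero, since X = {ξ | ·} is.
    cl⊆ : ∀ {γ} → Cl (_≡ X) γ → LeftEndZero γ
    cl⊆ = Cl-leftEndZero (λ { refl → move (allSmall⇒leftEndZero small ∷ []) [] })
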